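{- In the setting described in the context, if $f:B\to A$ is a cofibration (a map in $\mathcal{C}$) and a homotopy equivalence between fibrant objects, then $f$ is a strong homotopy equivalence.
   Context: Setting: $\mathcal{E}$ is an elementary topos. $\mathbb{I}$ is an object with a monomorphism $[\partial_0,\partial_1]:1+1\to\mathbb{I}$ and connections $\land,\lor:\mathbb{I}\times\mathbb{I}\to\mathbb{I}$ satisfying $i\land 0=0\land i=0$, $i\land 1=1\land i=i$, $i\lor 0=0\lor i=i$, $i\lor 1=1\lor i=1$. $\mathcal{C}$ is a class of monomorphisms which is a dominance (contains isos, closed under composition and pullback, classified by a subobject $\Sigma\subseteq\Omega$), closed under finite unions (including all $0\to X$), and contains $[\partial_0,\partial_1]$. The Leibniz product $f\hat\otimes g$ of $f:A\to B$, $g:C\to D$ is the induced map from the pushout of $f\times 1_C$ and $1_A\times g$ to $B\times D$. Fibration: right lifting property against all $\partial_i\hat\otimes u$, $u\in\mathcal{C}$, $i\in\{0,1\}$; $X$ is fibrant if $X\to 1$ is a fibration. A homotopy $H:f\simeq g$ between $f,g:B\to A$ is $H:\mathbb{I}\times B\to A$ with $H(\partial_0\times B)=f$, $H(\partial_1\times B)=g$. $f:B\to A$ is a homotopy equivalence if there is $g$ with $gf\simeq 1_B$, $fg\simeq 1_A$; it is a strong homotopy equivalence if there are $g:A\to B$, $H:gf\simeq 1_B$, $K:fg\simeq 1_A$ with $f\circ H=K\circ(\mathbb{I}\times f)$. -}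

module Defs where

open import Level using (Level; _⊔_) renaming (suc to lsuc)
open import Relation.Binary using (IsEquivalence)
open import Data.Product using (Σ; _×_; _,_; Σ-syntax; proj₁)
open import Data.Bool using (Bool; true; false)

record Category (o ℓ e : Level) : Set (lsuc (o ⊔ ℓ ⊔ e)) where
  infixr 9 _∘_
  infix 4 _≈_
  infix 3 _⇒_
  field
    Obj : Set o
    _⇒_ : Obj → Obj → Set ℓ
    _≈_ : ∀ {A B} → A ⇒ B → A ⇒ B → Set e
    id : ∀ {A} → A ⇒ A
    _∘_ : ∀ {A B C} → B ⇒ C → A ⇒ B → A ⇒ C
    ≈-equiv : ∀ {A B} → IsEquivalence (_≈_ {A} {B})
    ∘-resp-≈ : ∀ {A B C} {f h : B ⇒ C} {g i : A ⇒ B} → f ≈ h → g ≈ i → f ∘ g ≈ h ∘ i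
    assoc : ∀ {A B C D} {f : A ⇒ B} {g : B ⇒ C} {h : C ⇒ D} → (h ∘ g) ∘ f ≈ h ∘ (g ∘ f)
    identityˡ : ∀ {A B} {f : A ⇒ B} → id ∘ f ≈ f
    identityʳ : ∀ {A B} {f : A ⇒ B} → f ∘ id ≈ f

  ≈-refl : ∀ {A B} {f : A ⇒ B} → f ≈ f
  ≈-refl = IsEquivalence.refl ≈-equiv
  ≈-sym : ∀ {A B} {f g : A ⇒ B} → f ≈ g → g ≈ f
  ≈-sym = IsEquivalence.sym ≈-equiv
  ≈-trans : ∀ {A B} {f g h : A ⇒ B} → f ≈ g → g ≈ h → f ≈ h
  ≈-trans = IsEquivalence.trans ≈-equiv

module _ {o ℓ e : Level} (𝒞 : Category o ℓ e) where
  open Category 𝒞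

  Mono : ∀ {A B} → A ⇒ B → Set (o ⊔ ℓ ⊔ e)
  Mono {A} f = ∀ {X} (g h : X ⇒ A) → f ∘ g ≈ f ∘ h → g ≈ h

  IsIso : ∀ {A B} → A ⇒ B → Set (ℓ ⊔ e)
  IsIso {A} {B} f = Σ[ g ∈ B ⇒ A ] ((g ∘ f ≈ id) × (f ∘ g ≈ id))

  record Terminal : Set (o ⊔ ℓ ⊔ e) where
    field
      ⊤ : Obj
      ! : ∀ {A} → A ⇒ ⊤
      !-unique : ∀ {A} (f : A ⇒ ⊤) → f ≈ !

  record Initial : Set (o ⊔ ℓ ⊔ e) where
    field
      ⊥ : Obj
      ¡ : ∀ {A} → ⊥ ⇒ A
      ¡-unique : ∀ {A} (f : ⊥ ⇒ A) → f ≈ ¡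

  record Product (A B : Obj) : Set (o ⊔ ℓ ⊔ e) where
    field
      A×B : Obj
      π₁ : A×B ⇒ A
      π₂ : A×B ⇒ B
      ⟨_,_⟩ : ∀ {X} → X ⇒ A → X ⇒ B → X ⇒ A×B
      project₁ : ∀ {X} {f : X ⇒ A} {g : X ⇒ B} → π₁ ∘ ⟨ f , g ⟩ ≈ f
      project₂ : ∀ {X} {f : X ⇒ A} {g : X ⇒ B} → π₂ ∘ ⟨ f , g ⟩ ≈ g
      unique : ∀ {X} {h : X ⇒ A×B} {f : X ⇒ A} {g : X ⇒ B}
               → π₁ ∘ h ≈ f → π₂ ∘ h ≈ g → ⟨ f , g ⟩ ≈ h

  record Coproduct (A B : Obj) : Set (o ⊔ ℓ ⊔ e) where
    field
      A+B : Obj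
      ι₁ : A ⇒ A+B
      ι₂ : B ⇒ A+B
      [_,_] : ∀ {X} → A ⇒ X → B ⇒ X → A+B ⇒ X
      inject₁ : ∀ {X} {f : A ⇒ X} {g : B ⇒ X} → [ f , g ] ∘ ι₁ ≈ f
      inject₂ : ∀ {X} {f : A ⇒ X} {g : B ⇒ X} → [ f , g ] ∘ ι₂ ≈ g
      unique : ∀ {X} {h : A+B ⇒ X} {f : A ⇒ X} {g : B ⇒ X}
               → h ∘ ι₁ ≈ f → h ∘ ι₂ ≈ g → [ f , g ] ≈ h

  record IsPullback {P X Y Z : Obj} (f : X ⇒ Z) (g : Y ⇒ Z)
                    (p₁ : P ⇒ X) (p₂ : P ⇒ Y) : Set (o ⊔ ℓ ⊔ e) where
    field
      commute : f ∘ p₁ ≈ g ∘ p₂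
      universal : ∀ {Q} {h₁ : Q ⇒ X} {h₂ : Q ⇒ Y} → f ∘ h₁ ≈ g ∘ h₂ → Q ⇒ P
      p₁∘universal : ∀ {Q} {h₁ : Q ⇒ X} {h₂ : Q ⇒ Y} {eq : f ∘ h₁ ≈ g ∘ h₂}
                     → p₁ ∘ universal eq ≈ h₁
      p₂∘universal : ∀ {Q} {h₁ : Q ⇒ X} {h₂ : Q ⇒ Y} {eq : f ∘ h₁ ≈ g ∘ h₂}
                     → p₂ ∘ universal eq ≈ h₂
      unique : ∀ {Q} {h₁ : Q ⇒ X} {h₂ : Q ⇒ Y} {eq : f ∘ h₁ ≈ g ∘ h₂} {i : Q ⇒ P}
               → p₁ ∘ i ≈ h₁ → p₂ ∘ i ≈ h₂ → i ≈ universal eq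

  record Pullback {X Y Z : Obj} (f : X ⇒ Z) (g : Y ⇒ Z) : Set (o ⊔ ℓ ⊔ e) where
    field
      P : Obj
      p₁ : P ⇒ X
      p₂ : P ⇒ Y
      isPullback : IsPullback f g p₁ p₂
    open IsPullback isPullback public

  record Pushout {X Y Z : Obj} (f : X ⇒ Y) (g : X ⇒ Z) : Set (o ⊔ ℓ ⊔ e) where
    field
      Q : Obj
      i₁ : Y ⇒ Q
      i₂ : Z ⇒ Q
      commute : i₁ ∘ f ≈ i₂ ∘ g
      universal : ∀ {W} {h₁ : Y ⇒ W} {h₂ : Z ⇒ W} → h₁ ∘ f ≈ h₂ ∘ g → Q ⇒ W
      universal∘i₁ : ∀ {W} {h₁ : Y ⇒ W} {h₂ : Z ⇒ W} {eq : h₁ ∘ f ≈ h₂ ∘ g}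
                     → universal eq ∘ i₁ ≈ h₁
      universal∘i₂ : ∀ {W} {h₁ : Y ⇒ W} {h₂ : Z ⇒ W} {eq : h₁ ∘ f ≈ h₂ ∘ g}
                     → universal eq ∘ i₂ ≈ h₂
      unique : ∀ {W} {h₁ : Y ⇒ W} {h₂ : Z ⇒ W} {eq : h₁ ∘ f ≈ h₂ ∘ g} {j : Q ⇒ W}
               → j ∘ i₁ ≈ h₁ → j ∘ i₂ ≈ h₂ → j ≈ universal eq

  module ProductOps (prod : ∀ A B → Product A B) where
    infixr 7 _×₀_
    _×₀_ : Obj → Obj → Obj
    A ×₀ B = Product.A×B (prod A B)

    π₁ : ∀ {A B} → A ×₀ B ⇒ A
    π₁ {A} {B} = Product.π₁ (prod A B)
    π₂ : ∀ {A B} → A ×₀ B ⇒ B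
    π₂ {A} {B} = Product.π₂ (prod A B)
    ⟨_,_⟩ : ∀ {X A B} → X ⇒ A → X ⇒ B → X ⇒ A ×₀ B
    ⟨_,_⟩ {X} {A} {B} = Product.⟨_,_⟩ (prod A B)

    infixr 8 _⁂_
    _⁂_ : ∀ {A B C D} → A ⇒ B → C ⇒ D → A ×₀ C ⇒ B ×₀ D
    f ⁂ g = ⟨ f ∘ π₁ , g ∘ π₂ ⟩

    ⟨⟩-resp-≈ : ∀ {X A B} {f f' : X ⇒ A} {g g' : X ⇒ B}
                → f ≈ f' → g ≈ g' → ⟨ f , g ⟩ ≈ ⟨ f' , g' ⟩
    ⟨⟩-resp-≈ {X} {A} {B} p q =
      ≈-sym (Product.unique (prod A B)
        (≈-trans (Product.project₁ (prod A B)) p)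
        (≈-trans (Product.project₂ (prod A B)) q))

    ⁂∘⁂ : ∀ {A B C D E F} {f : B ⇒ C} {g : E ⇒ F} {h : A ⇒ B} {k : D ⇒ E}
          → (f ⁂ g) ∘ (h ⁂ k) ≈ (f ∘ h) ⁂ (g ∘ k)
    ⁂∘⁂ {A} {B} {C} {D} {E} {F} {f} {g} {h} {k} = ≈-sym (Product.unique (prod C F) l r)
      where
      l : π₁ ∘ ((f ⁂ g) ∘ (h ⁂ k)) ≈ (f ∘ h) ∘ π₁
      l = ≈-trans (≈-sym assoc)
          (≈-trans (∘-resp-≈ (Product.project₁ (prod C F)) ≈-refl)
          (≈-trans assoc
          (≈-trans (∘-resp-≈ ≈-refl (Product.project₁ (prod B E)))
          (≈-sym assoc))))
      r : π₂ ∘ ((f ⁂ g) ∘ (h ⁂ k)) ≈ (g ∘ k) ∘ π₂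
      r = ≈-trans (≈-sym assoc)
          (≈-trans (∘-resp-≈ (Product.project₂ (prod C F)) ≈-refl)
          (≈-trans assoc
          (≈-trans (∘-resp-≈ ≈-refl (Product.project₂ (prod B E)))
          (≈-sym assoc))))

    interchange : ∀ {A B C D} (f : A ⇒ B) (g : C ⇒ D)
                  → (id ⁂ g) ∘ (f ⁂ id) ≈ (f ⁂ id) ∘ (id ⁂ g)
    interchange f g =
      ≈-trans ⁂∘⁂
      (≈-trans (⟨⟩-resp-≈ (∘-resp-≈ (≈-trans identityˡ (≈-sym identityʳ)) ≈-refl)
                          (∘-resp-≈ (≈-trans identityʳ (≈-sym identityˡ)) ≈-refl))
      (≈-sym ⁂∘⁂))

  record Exponential (prod : ∀ A B → Product A B) (A B : Obj) : Set (o ⊔ ℓ ⊔ e) where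
    open ProductOps prod
    field
      B^A : Obj
      eval : B^A ×₀ A ⇒ B
      λg : ∀ {X} → X ×₀ A ⇒ B → X ⇒ B^A
      β : ∀ {X} {f : X ×₀ A ⇒ B} → eval ∘ (λg f ⁂ id) ≈ f
      λ-unique : ∀ {X} {f : X ×₀ A ⇒ B} {h : X ⇒ B^A} → eval ∘ (h ⁂ id) ≈ f → h ≈ λg f

  record SubobjectClassifier (term : Terminal) : Set (o ⊔ ℓ ⊔ e) where
    open Terminal term
    field
      Ω : Obj
      truth : ⊤ ⇒ Ω
      χ : ∀ {U X} (m : U ⇒ X) → Mono m → X ⇒ Ω
      χ-pullback : ∀ {U X} (m : U ⇒ X) (mono : Mono m) → IsPullback (χ m mono) truth m !
      χ-unique : ∀ {U X} (m : U ⇒ X) (mono : Mono m) (φ : X ⇒ Ω)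
                 → IsPullback φ truth m ! → φ ≈ χ m mono

-- An elementary topos (finite limits, exponentials, subobject classifier),
-- equipped additionally with chosen finite colimits (which exist in any topos).
record Topos (o ℓ e : Level) : Set (lsuc (o ⊔ ℓ ⊔ e)) where
  field
    cat : Category o ℓ e
  open Category cat public
  field
    terminal : Terminal cat
    product : ∀ A B → Product cat A B
    pullback : ∀ {X Y Z} (f : X ⇒ Z) (g : Y ⇒ Z) → Pullback cat f g
    exponential : ∀ A B → Exponential cat product A B
    classifier : SubobjectClassifier cat terminal
    initial : Initial cat
    coproduct : ∀ A B → Coproduct cat A B
    pushout : ∀ {X Y Z} (f : X ⇒ Y) (g : X ⇒ Z) → Pushout cat f g
  open Terminal terminal public
  open Initial initial public
  open SubobjectClassifier classifier public
  open ProductOps cat product public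

  infixr 7 _+₀_
  _+₀_ : Obj → Obj → Obj
  A +₀ B = Coproduct.A+B (coproduct A B)

  [_,_] : ∀ {A B X} → A ⇒ X → B ⇒ X → A +₀ B ⇒ X
  [_,_] {A} {B} = Coproduct.[_,_] (coproduct A B)

  -- union of two subobjects m, n of X: pushout of their intersection,
  -- with the induced map to X
  union : ∀ {U V X} (m : U ⇒ X) (n : V ⇒ X)
          → Pushout.Q (pushout (Pullback.p₁ (pullback m n)) (Pullback.p₂ (pullback m n))) ⇒ X
  union m n = Pushout.universal (pushout (Pullback.p₁ (pullback m n)) (Pullback.p₂ (pullback m n)))
                                (Pullback.commute (pullback m n))

  leibniz : ∀ {A B C D} (f : A ⇒ B) (g : C ⇒ D)
            → Pushout.Q (pushout (f ⁂ id {C}) (id {A} ⁂ g)) ⇒ B ×₀ D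
  leibniz f g = Pushout.universal (pushout (f ⁂ id) (id ⁂ g)) (interchange f g)

  RLP : ∀ {A B X Y} (i : A ⇒ B) (p : X ⇒ Y) → Set (ℓ ⊔ e)
  RLP {A} {B} {X} {Y} i p =
    ∀ (u : A ⇒ X) (v : B ⇒ Y) → p ∘ u ≈ v ∘ i →
      Σ[ d ∈ B ⇒ X ] ((d ∘ i ≈ u) × (p ∘ d ≈ v))

record Setting {o ℓ e : Level} (T : Topos o ℓ e) (c : Level) : Set (lsuc (o ⊔ ℓ ⊔ e ⊔ c)) where
  open Topos T
  field
    𝕀 : Obj
    ∂₀ ∂₁ : ⊤ ⇒ 𝕀
    ∂-mono : Mono cat [ ∂₀ , ∂₁ ]
    _∧_ _∨_ : 𝕀 ×₀ 𝕀 ⇒ 𝕀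
    ∧-0ʳ : _∧_ ∘ ⟨ id , ∂₀ ∘ ! ⟩ ≈ ∂₀ ∘ !
    ∧-0ˡ : _∧_ ∘ ⟨ ∂₀ ∘ ! , id ⟩ ≈ ∂₀ ∘ !
    ∧-1ʳ : _∧_ ∘ ⟨ id , ∂₁ ∘ ! ⟩ ≈ id
    ∧-1ˡ : _∧_ ∘ ⟨ ∂₁ ∘ ! , id ⟩ ≈ id
    ∨-0ʳ : _∨_ ∘ ⟨ id , ∂₀ ∘ ! ⟩ ≈ id
    ∨-0ˡ : _∨_ ∘ ⟨ ∂₀ ∘ ! , id ⟩ ≈ id
    ∨-1ʳ : _∨_ ∘ ⟨ id , ∂₁ ∘ ! ⟩ ≈ ∂₁ ∘ !
    ∨-1ˡ : _∨_ ∘ ⟨ ∂₁ ∘ ! , id ⟩ ≈ ∂₁ ∘ !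
    -- the class 𝒞 of cofibrations
    isC : ∀ {A B} → A ⇒ B → Set c
    C-resp-≈ : ∀ {A B} {f g : A ⇒ B} → f ≈ g → isC f → isC g
    C-mono : ∀ {A B} {m : A ⇒ B} → isC m → Mono cat m
    C-iso : ∀ {A B} {f : A ⇒ B} → IsIso cat f → isC f
    C-∘ : ∀ {A B C} {f : A ⇒ B} {g : B ⇒ C} → isC f → isC g → isC (g ∘ f)
    C-pullback : ∀ {P X Y Z} {m : X ⇒ Z} {g : Y ⇒ Z} {p₁ : P ⇒ X} {p₂ : P ⇒ Y}
                 → isC m → IsPullback cat m g p₁ p₂ → isC p₂
    Σ₀ : Obj
    s : Σ₀ ⇒ Ω
    s-mono : Mono cat s
    C-classified : ∀ {U X} (m : U ⇒ X) (mono : Mono cat m)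
                   → (isC m → Σ[ φ ∈ X ⇒ Σ₀ ] (s ∘ φ ≈ χ m mono))
                   × (Σ[ φ ∈ X ⇒ Σ₀ ] (s ∘ φ ≈ χ m mono) → isC m)
    C-⊥ : ∀ {X} → isC (¡ {X})
    C-union : ∀ {U V X} {m : U ⇒ X} {n : V ⇒ X} → isC m → isC n → isC (union m n)
    C-∂ : isC [ ∂₀ , ∂₁ ]

  ∂ : Bool → ⊤ ⇒ 𝕀
  ∂ false = ∂₀
  ∂ true = ∂₁

  IsFibration : ∀ {X Y} → X ⇒ Y → Set (o ⊔ ℓ ⊔ e ⊔ c)
  IsFibration p = ∀ {C D} (u : C ⇒ D) → isC u → (b : Bool) → RLP (leibniz (∂ b) u) p

  Fibrant : Obj → Set (o ⊔ ℓ ⊔ e ⊔ c)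
  Fibrant X = IsFibration (! {X})

  -- H : f ≃ g,  H ∘ (∂₀ × B) = f,  H ∘ (∂₁ × B) = g   (1 × B ≅ B via ⟨ ! , id ⟩)
  Homotopy : ∀ {B A} → B ⇒ A → B ⇒ A → Set (ℓ ⊔ e)
  Homotopy {B} {A} f g =
    Σ[ H ∈ 𝕀 ×₀ B ⇒ A ] ((H ∘ ⟨ ∂₀ ∘ ! , id ⟩ ≈ f) × (H ∘ ⟨ ∂₁ ∘ ! , id ⟩ ≈ g))

  IsHomotopyEquivalence : ∀ {B A} → B ⇒ A → Set (ℓ ⊔ e)
  IsHomotopyEquivalence {B} {A} f =
    Σ[ g ∈ A ⇒ B ] (Homotopy (g ∘ f) id × Homotopy (f ∘ g) id)

  IsStrongHomotopyEquivalence : ∀ {B A} → B ⇒ A → Set (ℓ ⊔ e)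
  IsStrongHomotopyEquivalence {B} {A} f =
    Σ[ g ∈ A ⇒ B ] Σ[ H ∈ Homotopy (g ∘ f) id ] Σ[ K ∈ Homotopy (f ∘ g) id ]
      (f ∘ proj₁ H ≈ proj₁ K ∘ (id ⁂ f))

-- Extending the homotopy H : g f ≃ 1 along the cofibration f into the fibrant B gives a map
-- r ≃ g with r f = 1 on the nose. Then f r ≃ f g ≃ 1, and filling one more open box against f,
-- whose part over B is (s , i , y) ↦ K (s ∨ i , f y), straightens this homotopy K : f r ≃ 1 so
-- that it is constant on B. With the constant homotopy r f = 1 this is a strong homotopy
-- equivalence. Each box is filled by fibrancy against ∂₀ ⊗̂ (∂𝕀 × A ∪ 𝕀 × B), the union being a
-- cofibration; gluing its two pieces uses that 𝕀 × - preserves pushouts (𝕀 × - has a right adjoint).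
module Submission where

open import Level using (Level)
open import Data.Bool using (Bool; false; true)
open import Data.Product using (Σ-syntax; _×_; _,_; proj₁; proj₂)
open import Relation.Binary.Bundles using (Setoid)
open import Defs

module CategoryProperties {o ℓ e : Level} (𝒞 : Category o ℓ e) where
  open Category 𝒞

  hom-setoid : Obj → Obj → Setoid ℓ e
  hom-setoid A B = record { Carrier = A ⇒ B ; _≈_ = _≈_ ; isEquivalence = ≈-equiv }

  module _ {A B : Obj} where
    open import Relation.Binary.Reasoning.Setoid (hom-setoid A B) public

  ∘-resp-≈ˡ : ∀ {A B C} {f h : B ⇒ C} {g : A ⇒ B} → f ≈ h → f ∘ g ≈ h ∘ g
  ∘-resp-≈ˡ p = ∘-resp-≈ p ≈-refl

  ∘-resp-≈ʳ : ∀ {A B C} {f : B ⇒ C} {g i : A ⇒ B} → g ≈ i → f ∘ g ≈ f ∘ i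
  ∘-resp-≈ʳ p = ∘-resp-≈ ≈-refl p

  sym-assoc : ∀ {A B C D} {f : A ⇒ B} {g : B ⇒ C} {h : C ⇒ D} → h ∘ (g ∘ f) ≈ (h ∘ g) ∘ f
  sym-assoc = ≈-sym assoc

  pullˡ : ∀ {W X Y Z} {a : Y ⇒ Z} {b : X ⇒ Y} {c : X ⇒ Z} {f : W ⇒ X}
          → a ∘ b ≈ c → a ∘ (b ∘ f) ≈ c ∘ f
  pullˡ p = ≈-trans sym-assoc (∘-resp-≈ˡ p)

  pullʳ : ∀ {W X Y Z} {a : X ⇒ Y} {b : W ⇒ X} {c : W ⇒ Y} {f : Y ⇒ Z}
          → a ∘ b ≈ c → (f ∘ a) ∘ b ≈ f ∘ c
  pullʳ p = ≈-trans assoc (∘-resp-≈ʳ p)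

  pushʳ : ∀ {W X Y Z} {a : X ⇒ Y} {b : W ⇒ X} {c : W ⇒ Y} {f : Y ⇒ Z}
          → a ∘ b ≈ c → f ∘ c ≈ (f ∘ a) ∘ b
  pushʳ p = ≈-sym (pullʳ p)

  pushout-jointly-epi : ∀ {P Y Z W} {p₁ : P ⇒ Y} {p₂ : P ⇒ Z} (po : Pushout 𝒞 p₁ p₂)
    {h k : Pushout.Q po ⇒ W} → h ∘ Pushout.i₁ po ≈ k ∘ Pushout.i₁ po
    → h ∘ Pushout.i₂ po ≈ k ∘ Pushout.i₂ po → h ≈ k
  pushout-jointly-epi {p₁ = p₁} {p₂} po {h} p q =
    ≈-trans (unique {eq = h-commutes} ≈-refl ≈-refl)
            (≈-sym (unique {eq = h-commutes} (≈-sym p) (≈-sym q)))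
    where
    open Pushout po
    h-commutes : (h ∘ i₁) ∘ p₁ ≈ (h ∘ i₂) ∘ p₂
    h-commutes = ≈-trans (pullʳ commute) sym-assoc

module CartesianClosed {o ℓ e : Level} (T : Topos o ℓ e) where
  open Topos T
  open CategoryProperties cat

  project₁ : ∀ {X A B} {f : X ⇒ A} {g : X ⇒ B} → π₁ ∘ ⟨ f , g ⟩ ≈ f
  project₁ {A = A} {B} = Product.project₁ (product A B)

  project₂ : ∀ {X A B} {f : X ⇒ A} {g : X ⇒ B} → π₂ ∘ ⟨ f , g ⟩ ≈ g
  project₂ {A = A} {B} = Product.project₂ (product A B)

  ⟨⟩-unique : ∀ {X A B} {h : X ⇒ A ×₀ B} {f : X ⇒ A} {g : X ⇒ B}
              → π₁ ∘ h ≈ f → π₂ ∘ h ≈ g → ⟨ f , g ⟩ ≈ h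
  ⟨⟩-unique {A = A} {B} = Product.unique (product A B)

  g-η : ∀ {X A B} {h : X ⇒ A ×₀ B} → ⟨ π₁ ∘ h , π₂ ∘ h ⟩ ≈ h
  g-η = ⟨⟩-unique ≈-refl ≈-refl

  η : ∀ {A B} → ⟨ π₁ , π₂ ⟩ ≈ id {A ×₀ B}
  η = ⟨⟩-unique identityʳ identityʳ

  ⟨⟩∘ : ∀ {W X A B} {f : X ⇒ A} {g : X ⇒ B} {h : W ⇒ X} → ⟨ f , g ⟩ ∘ h ≈ ⟨ f ∘ h , g ∘ h ⟩
  ⟨⟩∘ = ≈-sym (⟨⟩-unique (pullˡ project₁) (pullˡ project₂))

  ⁂∘⟨⟩ : ∀ {X A B C D} {f : A ⇒ C} {g : B ⇒ D} {h : X ⇒ A} {k : X ⇒ B}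
         → (f ⁂ g) ∘ ⟨ h , k ⟩ ≈ ⟨ f ∘ h , g ∘ k ⟩
  ⁂∘⟨⟩ = ≈-trans ⟨⟩∘ (⟨⟩-resp-≈ (pullʳ project₁) (pullʳ project₂))

  ⁂-cong₂ : ∀ {A B C D} {f f′ : A ⇒ B} {g g′ : C ⇒ D} → f ≈ f′ → g ≈ g′ → f ⁂ g ≈ f′ ⁂ g′
  ⁂-cong₂ p q = ⟨⟩-resp-≈ (∘-resp-≈ˡ p) (∘-resp-≈ˡ q)

  second-cong : ∀ {I A B} {g g′ : A ⇒ B} → g ≈ g′ → id {I} ⁂ g ≈ id ⁂ g′
  second-cong = ⁂-cong₂ ≈-refl

  id⁂id : ∀ {A B} → id {A} ⁂ id {B} ≈ id
  id⁂id = ≈-trans (⟨⟩-resp-≈ identityˡ identityˡ) η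

  first∘first : ∀ {A B C Y} {g : B ⇒ C} {k : A ⇒ B} → (g ⁂ id {Y}) ∘ (k ⁂ id) ≈ (g ∘ k) ⁂ id
  first∘first = ≈-trans ⁂∘⁂ (⁂-cong₂ ≈-refl identityˡ)

  second∘second : ∀ {A B C I} {g : B ⇒ C} {k : A ⇒ B} → (id {I} ⁂ g) ∘ (id ⁂ k) ≈ id ⁂ (g ∘ k)
  second∘second = ≈-trans ⁂∘⁂ (⁂-cong₂ identityˡ ≈-refl)

  second-slide : ∀ {A B C I X} {h : I ×₀ C ⇒ X} {g : B ⇒ C} {k : A ⇒ B}
                 → (h ∘ (id ⁂ g)) ∘ (id ⁂ k) ≈ h ∘ (id ⁂ (g ∘ k))
  second-slide = pullʳ second∘second

  !-unique₂ : ∀ {X} (f g : X ⇒ ⊤) → f ≈ g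
  !-unique₂ f g = ≈-trans (!-unique f) (≈-sym (!-unique g))

  ¡-unique₂ : ∀ {X} (f g : ⊥ ⇒ X) → f ≈ g
  ¡-unique₂ f g = ≈-trans (¡-unique f) (≈-sym (¡-unique g))

  at : ∀ {I X} → ⊤ ⇒ I → X ⇒ I ×₀ X
  at x = ⟨ x ∘ ! , id ⟩

  at∘ : ∀ {I X Y} {x : ⊤ ⇒ I} {h : X ⇒ Y} → at x ∘ h ≈ ⟨ x ∘ ! , h ⟩
  at∘ = ≈-trans ⟨⟩∘ (⟨⟩-resp-≈ (pullʳ (!-unique₂ _ _)) identityˡ)

  second∘at : ∀ {I X Y} {x : ⊤ ⇒ I} {h : X ⇒ Y} → (id ⁂ h) ∘ at x ≈ ⟨ x ∘ ! , h ⟩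
  second∘at = ≈-trans ⁂∘⟨⟩ (⟨⟩-resp-≈ identityˡ identityʳ)

  at-natural : ∀ {I X Y} {x : ⊤ ⇒ I} {h : X ⇒ Y} → at x ∘ h ≈ (id ⁂ h) ∘ at x
  at-natural = ≈-trans at∘ (≈-sym second∘at)

  at-restrict : ∀ {I X Y W} {d : I ×₀ Y ⇒ W} {k : X ⇒ Y} {G : I ×₀ X ⇒ W} {x : ⊤ ⇒ I}
                → d ∘ (id ⁂ k) ≈ G → (d ∘ at x) ∘ k ≈ G ∘ at x
  at-restrict p = ≈-trans (pullʳ at-natural) (pullˡ p)

  π₂-retraction : ∀ {I X Y} {h : X ⇒ I} {γ : X ⇒ Y} → (γ ∘ π₂) ∘ ⟨ h , id ⟩ ≈ γ
  π₂-retraction = ≈-trans (pullʳ project₂) identityʳ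

  ⁂id≈at∘π₂ : ∀ {I Y} {x : ⊤ ⇒ I} → x ⁂ id {Y} ≈ at x ∘ π₂
  ⁂id≈at∘π₂ = ≈-trans (⟨⟩-resp-≈ (∘-resp-≈ʳ (!-unique₂ _ _)) identityˡ) (≈-sym at∘)

  ⟨-,const⟩ : ∀ {I X} {h : X ⇒ I} {x : ⊤ ⇒ I} → ⟨ h , x ∘ ! ⟩ ≈ ⟨ id , x ∘ ! ⟩ ∘ h
  ⟨-,const⟩ = ≈-sym (≈-trans ⟨⟩∘ (⟨⟩-resp-≈ identityˡ (pullʳ (!-unique₂ _ _))))

  Exp : Obj → Obj → Obj
  Exp A B = Exponential.B^A (exponential A B)

  eval : ∀ {A B} → Exp A B ×₀ A ⇒ B
  eval {A} {B} = Exponential.eval (exponential A B)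

  λg : ∀ {X A B} → X ×₀ A ⇒ B → X ⇒ Exp A B
  λg {A = A} {B} = Exponential.λg (exponential A B)

  β : ∀ {X A B} {f : X ×₀ A ⇒ B} → eval ∘ (λg f ⁂ id) ≈ f
  β {A = A} {B} = Exponential.β (exponential A B)

  λ-unique : ∀ {X A B} {f : X ×₀ A ⇒ B} {h : X ⇒ Exp A B} → eval ∘ (h ⁂ id) ≈ f → h ≈ λg f
  λ-unique {A = A} {B} = Exponential.λ-unique (exponential A B)

  λ-cong : ∀ {X A B} {f f′ : X ×₀ A ⇒ B} → f ≈ f′ → λg f ≈ λg f′
  λ-cong p = λ-unique (≈-trans β p)

  λ-natural : ∀ {W X A B} {f : X ×₀ A ⇒ B} {k : W ⇒ X} → λg f ∘ k ≈ λg (f ∘ (k ⁂ id))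
  λ-natural = λ-unique (≈-trans (∘-resp-≈ʳ (≈-sym first∘first)) (pullˡ β))

  λ-injective : ∀ {X A B} {f f′ : X ×₀ A ⇒ B} → λg f ≈ λg f′ → f ≈ f′
  λ-injective {f = f} {f′} p = begin
    f                    ≈⟨ β ⟨
    eval ∘ (λg f ⁂ id)   ≈⟨ ∘-resp-≈ʳ (⁂-cong₂ p ≈-refl) ⟩
    eval ∘ (λg f′ ⁂ id)  ≈⟨ β ⟩
    f′                   ∎

  -- ⊥ × W is initial since its maps into X transpose to maps ⊥ → Exp W X.
  strict-initial : ∀ {W X} → W ⇒ ⊥ → (α β : W ⇒ X) → α ≈ β
  strict-initial h α β =
    ≈-trans (≈-sym (π₂-retraction {h = h}))
            (≈-trans (∘-resp-≈ˡ (λ-injective (¡-unique₂ _ _))) π₂-retraction)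

  swap : ∀ {A B} → A ×₀ B ⇒ B ×₀ A
  swap = ⟨ π₂ , π₁ ⟩

  swap∘swap : ∀ {A B} → swap {B} {A} ∘ swap ≈ id
  swap∘swap = ≈-trans ⟨⟩∘ (≈-trans (⟨⟩-resp-≈ project₂ project₁) η)

  swap∘⁂ : ∀ {A B C D} {a : A ⇒ B} {b : C ⇒ D} → swap ∘ (a ⁂ b) ≈ (b ⁂ a) ∘ swap
  swap∘⁂ = ≈-trans ⟨⟩∘ (≈-trans (⟨⟩-resp-≈ project₂ project₁) (≈-sym ⁂∘⟨⟩))

  module _ {P Y Z} {p₁ : P ⇒ Y} {p₂ : P ⇒ Z} (po : Pushout cat p₁ p₂) {I X : Obj}
           {f : I ×₀ Y ⇒ X} {g : I ×₀ Z ⇒ X} (f≈g : f ∘ (id ⁂ p₁) ≈ g ∘ (id ⁂ p₂)) where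
    open Pushout po using (Q; i₁; i₂; universal; universal∘i₁; universal∘i₂)

    private
      transpose : ∀ {V} → I ×₀ V ⇒ X → V ⇒ Exp I X
      transpose γ = λg (γ ∘ swap)

      transpose-natural : ∀ {U V} {γ : I ×₀ V ⇒ X} {k : U ⇒ V}
                          → transpose γ ∘ k ≈ transpose (γ ∘ (id ⁂ k))
      transpose-natural = ≈-trans λ-natural (λ-cong (≈-trans (pullʳ swap∘⁂) sym-assoc))

      ρ : Q ⇒ Exp I X
      ρ = universal (≈-trans transpose-natural
                    (≈-trans (λ-cong (∘-resp-≈ˡ f≈g)) (≈-sym transpose-natural)))

    ×-universal : I ×₀ Q ⇒ X
    ×-universal = (eval ∘ (ρ ⁂ id)) ∘ swap

    private
      ×-universal-restrict : ∀ {V} {k : V ⇒ Q} {γ : I ×₀ V ⇒ X}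
                             → ρ ∘ k ≈ transpose γ → ×-universal ∘ (id ⁂ k) ≈ γ
      ×-universal-restrict {k = k} {γ} ρk = begin
        ((eval ∘ (ρ ⁂ id)) ∘ swap) ∘ (id ⁂ k) ≈⟨ pullʳ swap∘⁂ ⟩
        (eval ∘ (ρ ⁂ id)) ∘ ((k ⁂ id) ∘ swap) ≈⟨ pullˡ (pullʳ first∘first) ⟩
        (eval ∘ ((ρ ∘ k) ⁂ id)) ∘ swap        ≈⟨ ∘-resp-≈ˡ (∘-resp-≈ʳ (⁂-cong₂ ρk ≈-refl)) ⟩
        (eval ∘ (transpose γ ⁂ id)) ∘ swap    ≈⟨ ∘-resp-≈ˡ β ⟩
        (γ ∘ swap) ∘ swap                      ≈⟨ pullʳ swap∘swap ⟩
        γ ∘ id                                 ≈⟨ identityʳ ⟩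
        γ                                      ∎

    ×-universal∘i₁ : ×-universal ∘ (id ⁂ i₁) ≈ f
    ×-universal∘i₁ = ×-universal-restrict universal∘i₁

    ×-universal∘i₂ : ×-universal ∘ (id ⁂ i₂) ≈ g
    ×-universal∘i₂ = ×-universal-restrict universal∘i₂

  𝟚 : Obj
  𝟚 = ⊤ +₀ ⊤

  ι : Bool → ⊤ ⇒ 𝟚
  ι false = Coproduct.ι₁ (coproduct ⊤ ⊤)
  ι true  = Coproduct.ι₂ (coproduct ⊤ ⊤)

  select : ∀ {X} → (Bool → ⊤ ⇒ X) → 𝟚 ⇒ X
  select x = [ x false , x true ]

  select∘ι : ∀ {X} (x : Bool → ⊤ ⇒ X) b → select x ∘ ι b ≈ x b
  select∘ι x false = Coproduct.inject₁ (coproduct ⊤ ⊤)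
  select∘ι x true  = Coproduct.inject₂ (coproduct ⊤ ⊤)

  𝟚-ext : ∀ {X} {h k : 𝟚 ⇒ X} → (∀ b → h ∘ ι b ≈ k ∘ ι b) → h ≈ k
  𝟚-ext p = ≈-trans (≈-sym (unique ≈-refl ≈-refl)) (unique (≈-sym (p false)) (≈-sym (p true)))
    where open Coproduct (coproduct ⊤ ⊤)

  cases : ∀ {Y Z} → (Bool → Y ⇒ Z) → 𝟚 ×₀ Y ⇒ Z
  cases h = eval ∘ (select (λ b → λg (h b ∘ π₂)) ⁂ id)

  cases∘ι : ∀ {Y Z} (h : Bool → Y ⇒ Z) b → cases h ∘ (ι b ⁂ id) ≈ h b ∘ π₂
  cases∘ι h b = ≈-trans (pullʳ first∘first)
                (≈-trans (∘-resp-≈ʳ (⁂-cong₂ (select∘ι (λ b → λg (h b ∘ π₂)) b) ≈-refl)) β)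

  ι⁂id-jointly-epi : ∀ {Y Z} {α β : 𝟚 ×₀ Y ⇒ Z}
                     → (∀ b → α ∘ (ι b ⁂ id) ≈ β ∘ (ι b ⁂ id)) → α ≈ β
  ι⁂id-jointly-epi p =
    λ-injective (𝟚-ext λ b → ≈-trans λ-natural (≈-trans (λ-cong (p b)) (≈-sym λ-natural)))

  shuffle : ∀ {I J Y} → I ×₀ (J ×₀ Y) ⇒ J ×₀ (I ×₀ Y)
  shuffle = ⟨ π₁ ∘ π₂ , ⟨ π₁ , π₂ ∘ π₂ ⟩ ⟩

  π₁∘π₂∘⁂ : ∀ {A A′ B B′ C C′} {a : A ⇒ A′} {b : B ⇒ B′} {c : C ⇒ C′}
            → (π₁ ∘ π₂) ∘ (a ⁂ (b ⁂ c)) ≈ b ∘ (π₁ ∘ π₂)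
  π₁∘π₂∘⁂ = ≈-trans (pullʳ project₂) (≈-trans (pullˡ project₁) assoc)

  π₂∘π₂∘⁂ : ∀ {A A′ B B′ C C′} {a : A ⇒ A′} {b : B ⇒ B′} {c : C ⇒ C′}
            → (π₂ ∘ π₂) ∘ (a ⁂ (b ⁂ c)) ≈ c ∘ (π₂ ∘ π₂)
  π₂∘π₂∘⁂ = ≈-trans (pullʳ project₂) (≈-trans (pullˡ project₂) assoc)

  shuffle∘⁂ : ∀ {A A′ B B′ C C′} {a : A ⇒ A′} {b : B ⇒ B′} {c : C ⇒ C′}
              → shuffle ∘ (a ⁂ (b ⁂ c)) ≈ (b ⁂ (a ⁂ c)) ∘ shuffle
  shuffle∘⁂ =
    ≈-trans ⟨⟩∘ (≈-trans (⟨⟩-resp-≈ π₁∘π₂∘⁂ (≈-trans ⟨⟩∘ (⟨⟩-resp-≈ project₁ π₂∘π₂∘⁂)))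
                         (≈-sym (≈-trans ⁂∘⟨⟩ (⟨⟩-resp-≈ ≈-refl ⁂∘⟨⟩))))

  shuffle∘shuffle : ∀ {I J Y} → shuffle {J} {I} {Y} ∘ shuffle ≈ id
  shuffle∘shuffle = ≈-trans ⟨⟩∘ (≈-trans (⟨⟩-resp-≈ (≈-trans (pullʳ project₂) project₁) inner) η)
    where
    inner : ⟨ π₁ , π₂ ∘ π₂ ⟩ ∘ shuffle ≈ π₂
    inner = ≈-trans ⟨⟩∘ (≈-trans (⟨⟩-resp-≈ project₁ (≈-trans (pullʳ project₂) project₂)) g-η)

  shuffle∘first : ∀ {I J J′ Y} {a : J ⇒ J′}
                  → shuffle {J′} {I} {Y} ∘ (a ⁂ id) ≈ (id ⁂ (a ⁂ id)) ∘ shuffle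
  shuffle∘first = ≈-trans (∘-resp-≈ʳ (⁂-cong₂ ≈-refl (≈-sym id⁂id))) shuffle∘⁂

  shuffle∘second-first : ∀ {I J J′ Y} {a : J ⇒ J′}
                         → shuffle ∘ (id {I} ⁂ (a ⁂ id {Y})) ≈ (a ⁂ id) ∘ shuffle
  shuffle∘second-first = ≈-trans shuffle∘⁂ (∘-resp-≈ˡ (⁂-cong₂ ≈-refl id⁂id))

  cases-under : ∀ {I Y Z} → (Bool → I ×₀ Y ⇒ Z) → I ×₀ (𝟚 ×₀ Y) ⇒ Z
  cases-under h = cases h ∘ shuffle

  cases-under∘ι : ∀ {I Y Z} (h : Bool → I ×₀ Y ⇒ Z) b
                  → cases-under h ∘ (id ⁂ (ι b ⁂ id)) ≈ h b ∘ (id ⁂ π₂)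
  cases-under∘ι h b =
    ≈-trans (pullʳ shuffle∘second-first)
    (≈-trans (pullˡ (cases∘ι h b))
             (pullʳ (≈-trans project₂ (⟨⟩-resp-≈ (≈-sym identityˡ) ≈-refl))))

  second-ι-jointly-epi : ∀ {I Y Z} {α β : I ×₀ (𝟚 ×₀ Y) ⇒ Z}
                         → (∀ b → α ∘ (id ⁂ (ι b ⁂ id)) ≈ β ∘ (id ⁂ (ι b ⁂ id))) → α ≈ β
  second-ι-jointly-epi {I} {Y} {Z} {α} {β} p = begin
    α                        ≈⟨ shuffle-cancel ⟨
    (α ∘ shuffle) ∘ shuffle  ≈⟨ ∘-resp-≈ˡ (ι⁂id-jointly-epi λ b →
                                  ≈-trans (shuffle-slide α b)
                                          (≈-trans (∘-resp-≈ˡ (p b)) (≈-sym (shuffle-slide β b)))) ⟩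
    (β ∘ shuffle) ∘ shuffle  ≈⟨ shuffle-cancel ⟩
    β                        ∎
    where
    shuffle-slide : ∀ (γ : I ×₀ (𝟚 ×₀ Y) ⇒ Z) b
                    → (γ ∘ shuffle) ∘ (ι b ⁂ id) ≈ (γ ∘ (id ⁂ (ι b ⁂ id))) ∘ shuffle
    shuffle-slide γ b = ≈-trans (pullʳ shuffle∘first) sym-assoc

    shuffle-cancel : ∀ {γ : I ×₀ (𝟚 ×₀ Y) ⇒ Z} → (γ ∘ shuffle) ∘ shuffle ≈ γ
    shuffle-cancel = ≈-trans (pullʳ shuffle∘shuffle) identityʳ

  π₁∘second : ∀ {I A B} {k : A ⇒ B} → π₁ ∘ (id {I} ⁂ k) ≈ π₁
  π₁∘second = ≈-trans project₁ identityˡ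

  π₂∘first : ∀ {A B Y} {k : A ⇒ B} → π₂ ∘ (k ⁂ id {Y}) ≈ π₂
  π₂∘first = ≈-trans project₂ identityˡ

  first-pullback : ∀ {X Y Z} (k : X ⇒ Y) → IsPullback cat k (π₁ {Y} {Z}) (π₁ {X} {Z}) (k ⁂ id)
  first-pullback k = record
    { commute      = ≈-sym project₁
    ; universal    = λ {_} {h₁} {h₂} _ → ⟨ h₁ , π₂ ∘ h₂ ⟩
    ; p₁∘universal = project₁
    ; p₂∘universal = λ {_} {_} {_} {eq} → ≈-trans ⁂∘⟨⟩ (≈-trans (⟨⟩-resp-≈ eq identityˡ) g-η)
    ; unique       = λ p q → ≈-trans (≈-sym g-η)
                               (⟨⟩-resp-≈ p (≈-trans (∘-resp-≈ˡ (≈-sym π₂∘first)) (pullʳ q)))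
    }

  second-pullback : ∀ {X Y Z} (k : Y ⇒ Z) → IsPullback cat k (π₂ {X} {Z}) (π₂ {X} {Y}) (id ⁂ k)
  second-pullback k = record
    { commute      = ≈-sym project₂
    ; universal    = λ {_} {h₁} {h₂} _ → ⟨ π₁ ∘ h₂ , h₁ ⟩
    ; p₁∘universal = project₂
    ; p₂∘universal = λ {_} {_} {_} {eq} → ≈-trans ⁂∘⟨⟩ (≈-trans (⟨⟩-resp-≈ identityˡ eq) g-η)
    ; unique       = λ p q → ≈-trans (≈-sym g-η)
                               (⟨⟩-resp-≈ (≈-trans (∘-resp-≈ˡ (≈-sym π₁∘second)) (pullʳ q)) p)
    }

  first-second-square : ∀ {W P I A B} {a : P ⇒ I} {b : B ⇒ A} {p : W ⇒ P ×₀ A} {q : W ⇒ I ×₀ B}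
    → (a ⁂ id) ∘ p ≈ (id ⁂ b) ∘ q
    → (p ≈ (id ⁂ b) ∘ ⟨ π₁ ∘ p , π₂ ∘ q ⟩) × (q ≈ (a ⁂ id) ∘ ⟨ π₁ ∘ p , π₂ ∘ q ⟩)
  first-second-square {a = a} {b} {p} {q} square =
    ≈-trans (≈-sym g-η) (≈-trans (⟨⟩-resp-≈ (≈-sym identityˡ) π₂∘p) (≈-sym ⁂∘⟨⟩)) ,
    ≈-trans (≈-sym g-η) (≈-trans (⟨⟩-resp-≈ π₁∘q (≈-sym identityˡ)) (≈-sym ⁂∘⟨⟩))
    where
    π₂∘p : π₂ ∘ p ≈ b ∘ (π₂ ∘ q)
    π₂∘p = ≈-trans (≈-sym (pullˡ π₂∘first))
           (≈-trans (∘-resp-≈ʳ square) (≈-trans (pullˡ project₂) assoc))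
    π₁∘q : π₁ ∘ q ≈ a ∘ (π₁ ∘ p)
    π₁∘q = ≈-trans (≈-sym (pullˡ π₁∘second))
           (≈-trans (∘-resp-≈ʳ (≈-sym square)) (≈-trans (pullˡ project₁) assoc))

module Fibrancy {o ℓ e c : Level} (T : Topos o ℓ e) (S : Setting T c) where
  open Topos T
  open Setting S using (𝕀; ∂₀; ∂₁; ∂; _∨_; ∨-0ʳ; ∨-1ʳ; ∨-0ˡ; ∨-1ˡ; isC; C-pullback; C-⊥; C-union; C-∂;
                        Fibrant; Homotopy)
  open CategoryProperties cat
  open CartesianClosed T

  homotopy-extension : ∀ {X C D} → Fibrant X → {u : C ⇒ D} → isC u → (b : Bool)
    → (φ : 𝕀 ×₀ C ⇒ X) (ψ : D ⇒ X) → φ ∘ at (∂ b) ≈ ψ ∘ u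
    → Σ[ d ∈ 𝕀 ×₀ D ⇒ X ] (d ∘ (id ⁂ u) ≈ φ) × (d ∘ at (∂ b) ≈ ψ)
  homotopy-extension {X} {D = D} X-fibrant {u} u∈C b φ ψ φ≈ψ =
    d , d-restrict universal∘i₁ universal∘i₁ , d∘at
    where
    open Pushout (pushout (∂ b ⁂ id) (id ⁂ u))

    φ-compatible : φ ∘ (∂ b ⁂ id) ≈ (ψ ∘ π₂) ∘ (id ⁂ u)
    φ-compatible = begin
      φ ∘ (∂ b ⁂ id)       ≈⟨ ∘-resp-≈ʳ ⁂id≈at∘π₂ ⟩
      φ ∘ (at (∂ b) ∘ π₂)  ≈⟨ pullˡ φ≈ψ ⟩
      (ψ ∘ u) ∘ π₂         ≈⟨ assoc ⟩
      ψ ∘ (u ∘ π₂)         ≈⟨ pushʳ project₂ ⟩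
      (ψ ∘ π₂) ∘ (id ⁂ u)  ∎

    lift : Σ[ d ∈ 𝕀 ×₀ D ⇒ X ] (d ∘ leibniz (∂ b) u ≈ universal φ-compatible) × (! ∘ d ≈ !)
    lift = X-fibrant u u∈C b (universal φ-compatible) ! (!-unique₂ _ _)

    d : 𝕀 ×₀ D ⇒ X
    d = proj₁ lift

    d-restrict : ∀ {V} {i : V ⇒ Q} {k : V ⇒ 𝕀 ×₀ D} {h : V ⇒ X}
                 → leibniz (∂ b) u ∘ i ≈ k → universal φ-compatible ∘ i ≈ h → d ∘ k ≈ h
    d-restrict p q = ≈-trans (∘-resp-≈ʳ (≈-sym p)) (≈-trans (pullˡ (proj₁ (proj₂ lift))) q)

    d∘at : d ∘ at (∂ b) ≈ ψ
    d∘at = begin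
      d ∘ at (∂ b)                    ≈⟨ ∘-resp-≈ʳ (≈-trans ⁂∘⟨⟩ (⟨⟩-resp-≈ ≈-refl identityˡ)) ⟨
      d ∘ ((∂ b ⁂ id) ∘ ⟨ ! , id ⟩)   ≈⟨ pullˡ (d-restrict universal∘i₂ universal∘i₂) ⟩
      (ψ ∘ π₂) ∘ ⟨ ! , id ⟩           ≈⟨ π₂-retraction ⟩
      ψ                               ∎

  C-first : ∀ {X Y Z} {k : X ⇒ Y} → isC k → isC (k ⁂ id {Z})
  C-first k∈C = C-pullback k∈C (first-pullback _)

  C-second : ∀ {X Y Z} {k : Y ⇒ Z} → isC k → isC (id {X} ⁂ k)
  C-second k∈C = C-pullback k∈C (second-pullback _)

  ∂𝕀 : 𝟚 ⇒ 𝕀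
  ∂𝕀 = select ∂

  ∂𝕀⁂id∘ι : ∀ {Y} b → (∂𝕀 ⁂ id {Y}) ∘ (ι b ⁂ id) ≈ at (∂ b) ∘ π₂
  ∂𝕀⁂id∘ι b = ≈-trans first∘first (≈-trans (⁂-cong₂ (select∘ι ∂ b) ≈-refl) ⁂id≈at∘π₂)

  -- An open box in 𝕀 × 𝕀 × A whose first coordinate is the filling direction: ψ is the bottom,
  -- F b the side over the end ∂ b of the second coordinate, and Θ the part lying over B.
  module OpenBox {X A B : Obj} (X-fibrant : Fibrant X) {j : B ⇒ A} (j∈C : isC j)
    (F : Bool → 𝕀 ×₀ A ⇒ X) (Θ : 𝕀 ×₀ (𝕀 ×₀ B) ⇒ X) (ψ : 𝕀 ×₀ A ⇒ X)
    (F≈Θ : ∀ b → F b ∘ (id ⁂ j) ≈ Θ ∘ (id ⁂ at (∂ b)))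
    (F≈ψ : ∀ b → F b ∘ at ∂₀ ≈ ψ ∘ at (∂ b))
    (Θ≈ψ : Θ ∘ at ∂₀ ≈ ψ ∘ (id ⁂ j))
    where

    open Pullback (pullback (∂𝕀 ⁂ id) (id ⁂ j)) using (p₁; p₂; commute)

    po : Pushout cat p₁ p₂
    po = pushout p₁ p₂

    open Pushout po using (Q; i₁; i₂)

    boundary : Q ⇒ 𝕀 ×₀ A
    boundary = union (∂𝕀 ⁂ id) (id ⁂ j)

    boundary∈C : isC boundary
    boundary∈C = C-union (C-first C-∂) (C-second j∈C)

    boundary∘i₁ : boundary ∘ i₁ ≈ ∂𝕀 ⁂ id
    boundary∘i₁ = Pushout.universal∘i₁ po

    boundary∘i₂ : boundary ∘ i₂ ≈ id ⁂ j
    boundary∘i₂ = Pushout.universal∘i₂ po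

    sides : 𝕀 ×₀ (𝟚 ×₀ A) ⇒ X
    sides = cases-under F

    sides∘second-j : sides ∘ (id ⁂ (id ⁂ j)) ≈ Θ ∘ (id ⁂ (∂𝕀 ⁂ id))
    sides∘second-j = second-ι-jointly-epi λ b → begin
      (sides ∘ (id ⁂ (id ⁂ j))) ∘ (id ⁂ (ι b ⁂ id)) ≈⟨ second-slide ⟩
      sides ∘ (id ⁂ ((id ⁂ j) ∘ (ι b ⁂ id)))        ≈⟨ ∘-resp-≈ʳ (second-cong (interchange (ι b) j)) ⟩
      sides ∘ (id ⁂ ((ι b ⁂ id) ∘ (id ⁂ j)))        ≈⟨ second-slide ⟨
      (sides ∘ (id ⁂ (ι b ⁂ id))) ∘ (id ⁂ (id ⁂ j)) ≈⟨ ∘-resp-≈ˡ (cases-under∘ι F b) ⟩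
      (F b ∘ (id ⁂ π₂)) ∘ (id ⁂ (id ⁂ j))           ≈⟨ second-slide ⟩
      F b ∘ (id ⁂ (π₂ ∘ (id ⁂ j)))                  ≈⟨ ∘-resp-≈ʳ (second-cong project₂) ⟩
      F b ∘ (id ⁂ (j ∘ π₂))                         ≈⟨ second-slide ⟨
      (F b ∘ (id ⁂ j)) ∘ (id ⁂ π₂)                  ≈⟨ ∘-resp-≈ˡ (F≈Θ b) ⟩
      (Θ ∘ (id ⁂ at (∂ b))) ∘ (id ⁂ π₂)             ≈⟨ second-slide ⟩
      Θ ∘ (id ⁂ (at (∂ b) ∘ π₂))                    ≈⟨ ∘-resp-≈ʳ (second-cong (∂𝕀⁂id∘ι b)) ⟨
      Θ ∘ (id ⁂ ((∂𝕀 ⁂ id) ∘ (ι b ⁂ id)))           ≈⟨ second-slide ⟨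
      (Θ ∘ (id ⁂ (∂𝕀 ⁂ id))) ∘ (id ⁂ (ι b ⁂ id))    ∎

    sides-agree : sides ∘ (id ⁂ p₁) ≈ Θ ∘ (id ⁂ p₂)
    sides-agree = begin
      sides ∘ (id ⁂ p₁)                          ≈⟨ ∘-resp-≈ʳ (second-cong (proj₁ p₁,p₂-factor)) ⟩
      sides ∘ (id ⁂ ((id ⁂ j) ∘ corner))         ≈⟨ second-slide ⟨
      (sides ∘ (id ⁂ (id ⁂ j))) ∘ (id ⁂ corner)  ≈⟨ ∘-resp-≈ˡ sides∘second-j ⟩
      (Θ ∘ (id ⁂ (∂𝕀 ⁂ id))) ∘ (id ⁂ corner)     ≈⟨ second-slide ⟩
      Θ ∘ (id ⁂ ((∂𝕀 ⁂ id) ∘ corner))            ≈⟨ ∘-resp-≈ʳ (second-cong (proj₂ p₁,p₂-factor)) ⟨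
      Θ ∘ (id ⁂ p₂)                              ∎
      where
      corner : Pullback.P (pullback (∂𝕀 ⁂ id) (id ⁂ j)) ⇒ 𝟚 ×₀ B
      corner = ⟨ π₁ ∘ p₁ , π₂ ∘ p₂ ⟩
      p₁,p₂-factor : (p₁ ≈ (id ⁂ j) ∘ corner) × (p₂ ≈ (∂𝕀 ⁂ id) ∘ corner)
      p₁,p₂-factor = first-second-square commute

    sides∘at₀ : sides ∘ at ∂₀ ≈ ψ ∘ (∂𝕀 ⁂ id)
    sides∘at₀ = ι⁂id-jointly-epi λ b → begin
      (sides ∘ at ∂₀) ∘ (ι b ⁂ id)  ≈⟨ at-restrict (cases-under∘ι F b) ⟩
      (F b ∘ (id ⁂ π₂)) ∘ at ∂₀     ≈⟨ at-restrict ≈-refl ⟨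
      (F b ∘ at ∂₀) ∘ π₂            ≈⟨ ∘-resp-≈ˡ (F≈ψ b) ⟩
      (ψ ∘ at (∂ b)) ∘ π₂           ≈⟨ assoc ⟩
      ψ ∘ (at (∂ b) ∘ π₂)           ≈⟨ pullʳ (∂𝕀⁂id∘ι b) ⟨
      (ψ ∘ (∂𝕀 ⁂ id)) ∘ (ι b ⁂ id)  ∎

    glued : 𝕀 ×₀ Q ⇒ X
    glued = ×-universal po sides-agree

    glued-base : glued ∘ at ∂₀ ≈ ψ ∘ boundary
    glued-base = pushout-jointly-epi po
      (≈-trans (at-restrict (×-universal∘i₁ po sides-agree))
               (≈-trans sides∘at₀ (pushʳ boundary∘i₁)))
      (≈-trans (at-restrict (×-universal∘i₂ po sides-agree))
               (≈-trans Θ≈ψ (pushʳ boundary∘i₂)))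

    -- Only the stated properties of the extension matter; opacity keeps elaboration from unfolding it.
    opaque
      extension : Σ[ D ∈ 𝕀 ×₀ (𝕀 ×₀ A) ⇒ X ] (D ∘ (id ⁂ boundary) ≈ glued) × (D ∘ at ∂₀ ≈ ψ)
      extension = homotopy-extension X-fibrant boundary∈C false glued ψ glued-base

    D : 𝕀 ×₀ (𝕀 ×₀ A) ⇒ X
    D = proj₁ extension

    D-restrict : ∀ {V} {k : V ⇒ Q} {h : V ⇒ 𝕀 ×₀ A} {G : 𝕀 ×₀ V ⇒ X}
                 → boundary ∘ k ≈ h → glued ∘ (id ⁂ k) ≈ G → D ∘ (id ⁂ h) ≈ G
    D-restrict p q = ≈-trans (∘-resp-≈ʳ (second-cong (≈-sym p)))
                     (≈-trans (≈-sym second-slide) (≈-trans (∘-resp-≈ˡ (proj₁ (proj₂ extension))) q))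

    D∘second-∂𝕀 : D ∘ (id ⁂ (∂𝕀 ⁂ id)) ≈ sides
    D∘second-∂𝕀 = D-restrict boundary∘i₁ (×-universal∘i₁ po sides-agree)

    D∘second-j : D ∘ (id ⁂ (id ⁂ j)) ≈ Θ
    D∘second-j = D-restrict boundary∘i₂ (×-universal∘i₂ po sides-agree)

    D∘second-at : ∀ b → D ∘ (id ⁂ at (∂ b)) ≈ F b
    D∘second-at b = begin
      D ∘ (id ⁂ at (∂ b))                                        ≈⟨ ∘-resp-≈ʳ (second-cong at∂b≈) ⟩
      D ∘ (id ⁂ ((∂𝕀 ⁂ id) ∘ ((ι b ⁂ id) ∘ ⟨ ! , id ⟩)))         ≈⟨ second-slide ⟨
      (D ∘ (id ⁂ (∂𝕀 ⁂ id))) ∘ (id ⁂ ((ι b ⁂ id) ∘ ⟨ ! , id ⟩))  ≈⟨ ∘-resp-≈ˡ D∘second-∂𝕀 ⟩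
      sides ∘ (id ⁂ ((ι b ⁂ id) ∘ ⟨ ! , id ⟩))                   ≈⟨ second-slide ⟨
      (sides ∘ (id ⁂ (ι b ⁂ id))) ∘ (id ⁂ ⟨ ! , id ⟩)            ≈⟨ ∘-resp-≈ˡ (cases-under∘ι F b) ⟩
      (F b ∘ (id ⁂ π₂)) ∘ (id ⁂ ⟨ ! , id ⟩)                      ≈⟨ second-slide ⟩
      F b ∘ (id ⁂ (π₂ ∘ ⟨ ! , id ⟩))                             ≈⟨ ∘-resp-≈ʳ (≈-trans (second-cong project₂) id⁂id) ⟩
      F b ∘ id                                                   ≈⟨ identityʳ ⟩
      F b                                                        ∎
      where
      at∂b≈ : at (∂ b) ≈ (∂𝕀 ⁂ id) ∘ ((ι b ⁂ id) ∘ ⟨ ! , id ⟩)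
      at∂b≈ = ≈-sym (≈-trans sym-assoc (≈-trans (∘-resp-≈ˡ (∂𝕀⁂id∘ι b)) π₂-retraction))

    filler : 𝕀 ×₀ A ⇒ X
    filler = D ∘ at ∂₁

    filler∘at : ∀ b → filler ∘ at (∂ b) ≈ F b ∘ at ∂₁
    filler∘at b = at-restrict (D∘second-at b)

    filler∘j : filler ∘ (id ⁂ j) ≈ Θ ∘ at ∂₁
    filler∘j = at-restrict D∘second-j

  ∨-0ʳ′ : ∀ {X} {h : X ⇒ 𝕀} → _∨_ ∘ ⟨ h , ∂₀ ∘ ! ⟩ ≈ h
  ∨-0ʳ′ = ≈-trans (∘-resp-≈ʳ ⟨-,const⟩) (≈-trans (pullˡ ∨-0ʳ) identityˡ)

  ∨-1ʳ′ : ∀ {X} {h : X ⇒ 𝕀} → _∨_ ∘ ⟨ h , ∂₁ ∘ ! ⟩ ≈ ∂₁ ∘ !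
  ∨-1ʳ′ = ≈-trans (∘-resp-≈ʳ ⟨-,const⟩) (≈-trans (pullˡ ∨-1ʳ) (pullʳ (!-unique₂ _ _)))

  ∨-0ˡ′ : ∀ {X} {h : X ⇒ 𝕀} → _∨_ ∘ ⟨ ∂₀ ∘ ! , h ⟩ ≈ h
  ∨-0ˡ′ = ≈-trans (∘-resp-≈ʳ (≈-sym at∘)) (≈-trans (pullˡ ∨-0ˡ) identityˡ)

  ∨-1ˡ′ : ∀ {X} {h : X ⇒ 𝕀} → _∨_ ∘ ⟨ ∂₁ ∘ ! , h ⟩ ≈ ∂₁ ∘ !
  ∨-1ˡ′ = ≈-trans (∘-resp-≈ʳ (≈-sym at∘)) (≈-trans (pullˡ ∨-1ˡ) (pullʳ (!-unique₂ _ _)))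

  ≈⇒Homotopy : ∀ {Y X} {u v : Y ⇒ X} → u ≈ v → Homotopy u v
  ≈⇒Homotopy {v = v} u≈v = v ∘ π₂ , ≈-trans π₂-retraction (≈-sym u≈v) , π₂-retraction

  postcompose-homotopy : ∀ {Y X Z} {u v : Y ⇒ X} (h : X ⇒ Z) → Homotopy u v → Homotopy (h ∘ u) (h ∘ v)
  postcompose-homotopy h (H , H₀ , H₁) = h ∘ H , pullʳ H₀ , pullʳ H₁

  homotopy-euclidean : ∀ {Y X} {u v w : Y ⇒ X} → Fibrant X → Homotopy u v → Homotopy u w → Homotopy v w
  homotopy-euclidean {Y} {X} {v = v} {w} X-fibrant (P , P₀ , P₁) (Q , Q₀ , Q₁) =
    filler , filler∘at₀ , filler∘at₁
    where
    F : Bool → 𝕀 ×₀ Y ⇒ X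
    F false = P
    F true  = w ∘ π₂

    F≈Q : ∀ i → F i ∘ at ∂₀ ≈ Q ∘ at (∂ i)
    F≈Q false = ≈-trans P₀ (≈-sym Q₀)
    F≈Q true  = ≈-trans π₂-retraction (≈-sym Q₁)

    open OpenBox X-fibrant (C-⊥ {Y}) F (¡ ∘ (π₂ ∘ π₂)) Q
                 (λ _ → strict-initial π₂ _ _) F≈Q (strict-initial π₂ _ _)

    filler∘at₀ : filler ∘ at ∂₀ ≈ v
    filler∘at₀ = begin
      filler ∘ at ∂₀  ≈⟨ filler∘at false ⟩
      P ∘ at ∂₁       ≈⟨ P₁ ⟩
      v               ∎

    filler∘at₁ : filler ∘ at ∂₁ ≈ w
    filler∘at₁ = begin
      filler ∘ at ∂₁    ≈⟨ filler∘at true ⟩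
      (w ∘ π₂) ∘ at ∂₁  ≈⟨ π₂-retraction ⟩
      w                 ∎

  strictify-left-inverse : ∀ {A B} {f : B ⇒ A} {g : A ⇒ B} → Fibrant B → isC f
    → Homotopy (g ∘ f) id → Σ[ r ∈ A ⇒ B ] (r ∘ f ≈ id) × Homotopy g r
  strictify-left-inverse {g = g} B-fibrant f∈C (H , H₀ , H₁) =
    let (L , L∘f≈H , L₀) = homotopy-extension B-fibrant f∈C false H g H₀
    in L ∘ at ∂₁ , ≈-trans (at-restrict L∘f≈H) H₁ , L , L₀ , ≈-refl

  module ConnectionSquare {A B X} (K : 𝕀 ×₀ A ⇒ X) (f : B ⇒ A) where
    square : 𝕀 ×₀ (𝕀 ×₀ B) ⇒ X
    square = K ∘ ⟨ _∨_ ∘ ⟨ π₁ , π₁ ∘ π₂ ⟩ , f ∘ (π₂ ∘ π₂) ⟩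

    private
      square∘⟨⟩ : ∀ {W} {s i : W ⇒ 𝕀} {y : W ⇒ B}
                  → square ∘ ⟨ s , ⟨ i , y ⟩ ⟩ ≈ K ∘ ⟨ _∨_ ∘ ⟨ s , i ⟩ , f ∘ y ⟩
      square∘⟨⟩ = pullʳ (≈-trans ⟨⟩∘ (⟨⟩-resp-≈
                    (pullʳ (≈-trans ⟨⟩∘ (⟨⟩-resp-≈ project₁ (≈-trans (pullʳ project₂) project₁))))
                    (pullʳ (≈-trans (pullʳ project₂) project₂))))

      square∘second-at : ∀ {x} → square ∘ (id ⁂ at x) ≈ K ∘ ⟨ _∨_ ∘ ⟨ π₁ , x ∘ ! ⟩ , f ∘ π₂ ⟩
      square∘second-at = ≈-trans (∘-resp-≈ʳ (⟨⟩-resp-≈ identityˡ at∘)) square∘⟨⟩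

      square∘at : ∀ {x} → square ∘ at x ≈ K ∘ ⟨ _∨_ ∘ ⟨ x ∘ ! , π₁ ⟩ , f ∘ π₂ ⟩
      square∘at = ≈-trans (∘-resp-≈ʳ (⟨⟩-resp-≈ ≈-refl (≈-sym η))) square∘⟨⟩

      K∘⟨π₁,f∘π₂⟩ : K ∘ ⟨ π₁ , f ∘ π₂ ⟩ ≈ K ∘ (id ⁂ f)
      K∘⟨π₁,f∘π₂⟩ = ∘-resp-≈ʳ (⟨⟩-resp-≈ (≈-sym identityˡ) ≈-refl)

      K∘⟨∂₁,f∘π₂⟩ : K ∘ ⟨ ∂₁ ∘ ! , f ∘ π₂ {𝕀} ⟩ ≈ (K ∘ at ∂₁) ∘ (f ∘ π₂)
      K∘⟨∂₁,f∘π₂⟩ = ≈-trans (∘-resp-≈ʳ (≈-sym at∘)) sym-assoc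

    square∘second-at₀ : square ∘ (id ⁂ at ∂₀) ≈ K ∘ (id ⁂ f)
    square∘second-at₀ =
      ≈-trans square∘second-at (≈-trans (∘-resp-≈ʳ (⟨⟩-resp-≈ ∨-0ʳ′ ≈-refl)) K∘⟨π₁,f∘π₂⟩)

    square∘second-at₁ : square ∘ (id ⁂ at ∂₁) ≈ (K ∘ at ∂₁) ∘ (f ∘ π₂)
    square∘second-at₁ =
      ≈-trans square∘second-at (≈-trans (∘-resp-≈ʳ (⟨⟩-resp-≈ ∨-1ʳ′ ≈-refl)) K∘⟨∂₁,f∘π₂⟩)

    square∘at₀ : square ∘ at ∂₀ ≈ K ∘ (id ⁂ f)
    square∘at₀ =
      ≈-trans square∘at (≈-trans (∘-resp-≈ʳ (⟨⟩-resp-≈ ∨-0ˡ′ ≈-refl)) K∘⟨π₁,f∘π₂⟩)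

    square∘at₁ : square ∘ at ∂₁ ≈ (K ∘ at ∂₁) ∘ (f ∘ π₂)
    square∘at₁ =
      ≈-trans square∘at (≈-trans (∘-resp-≈ʳ (⟨⟩-resp-≈ ∨-1ˡ′ ≈-refl)) K∘⟨∂₁,f∘π₂⟩)

  strong-deformation-retract : ∀ {A B} {f : B ⇒ A} {r : A ⇒ B} → Fibrant A → isC f → r ∘ f ≈ id
    → Homotopy (f ∘ r) id → Σ[ K ∈ Homotopy (f ∘ r) id ] (proj₁ K ∘ (id ⁂ f) ≈ f ∘ π₂)
  strong-deformation-retract {A} {B} {f} {r} A-fibrant f∈C r∘f≈id (K , K₀ , K₁) =
    (filler , filler∘at₀ , filler∘at₁) , filler∘f
    where
    open ConnectionSquare K f

    K∘at₁∘ : ∀ {W} {h : W ⇒ A} → (K ∘ at ∂₁) ∘ h ≈ h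
    K∘at₁∘ = ≈-trans (∘-resp-≈ˡ K₁) identityˡ

    F : Bool → 𝕀 ×₀ A ⇒ A
    F false = K ∘ (id ⁂ (f ∘ r))
    F true  = π₂

    F≈square : ∀ i → F i ∘ (id ⁂ f) ≈ square ∘ (id ⁂ at (∂ i))
    F≈square false = begin
      (K ∘ (id ⁂ (f ∘ r))) ∘ (id ⁂ f)  ≈⟨ second-slide ⟩
      K ∘ (id ⁂ ((f ∘ r) ∘ f))         ≈⟨ ∘-resp-≈ʳ (second-cong (≈-trans (pullʳ r∘f≈id) identityʳ)) ⟩
      K ∘ (id ⁂ f)                     ≈⟨ square∘second-at₀ ⟨
      square ∘ (id ⁂ at ∂₀)            ∎
    F≈square true = begin
      π₂ ∘ (id ⁂ f)                    ≈⟨ project₂ ⟩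
      f ∘ π₂                           ≈⟨ K∘at₁∘ ⟨
      (K ∘ at ∂₁) ∘ (f ∘ π₂)           ≈⟨ square∘second-at₁ ⟨
      square ∘ (id ⁂ at ∂₁)            ∎

    F≈K : ∀ i → F i ∘ at ∂₀ ≈ K ∘ at (∂ i)
    F≈K false = begin
      (K ∘ (id ⁂ (f ∘ r))) ∘ at ∂₀  ≈⟨ at-restrict ≈-refl ⟨
      (K ∘ at ∂₀) ∘ (f ∘ r)         ≈⟨ ∘-resp-≈ˡ K₀ ⟩
      (f ∘ r) ∘ (f ∘ r)             ≈⟨ pullʳ (≈-trans (pullˡ r∘f≈id) identityˡ) ⟩
      f ∘ r                         ≈⟨ K₀ ⟨
      K ∘ at ∂₀                     ∎
    F≈K true = ≈-trans project₂ (≈-sym K₁)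

    open OpenBox A-fibrant f∈C F square K F≈square F≈K square∘at₀

    filler∘at₀ : filler ∘ at ∂₀ ≈ f ∘ r
    filler∘at₀ = begin
      filler ∘ at ∂₀                ≈⟨ filler∘at false ⟩
      (K ∘ (id ⁂ (f ∘ r))) ∘ at ∂₁  ≈⟨ at-restrict ≈-refl ⟨
      (K ∘ at ∂₁) ∘ (f ∘ r)         ≈⟨ K∘at₁∘ ⟩
      f ∘ r                         ∎

    filler∘at₁ : filler ∘ at ∂₁ ≈ id
    filler∘at₁ = ≈-trans (filler∘at true) project₂

    filler∘f : filler ∘ (id ⁂ f) ≈ f ∘ π₂
    filler∘f = ≈-trans filler∘j (≈-trans square∘at₁ K∘at₁∘)

proposition3p15 : ∀ {o ℓ e c : Level} (T : Topos o ℓ e) (S : Setting T c)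
    → ∀ {A B : Topos.Obj T} (f : Topos._⇒_ T B A)
    → Setting.isC S f → Setting.Fibrant S A → Setting.Fibrant S B
    → Setting.IsHomotopyEquivalence S f → Setting.IsStrongHomotopyEquivalence S f
proposition3p15 T S f f∈C A-fibrant B-fibrant (g , g∘f≃id , f∘g≃id) =
  let (r , r∘f≈id , g≃r) = strictify-left-inverse B-fibrant f∈C g∘f≃id
      f∘r≃id             = homotopy-euclidean A-fibrant (postcompose-homotopy f g≃r) f∘g≃id
      (K , K∘f≈f∘π₂)     = strong-deformation-retract A-fibrant f∈C r∘f≈id f∘r≃id
  in r , ≈⇒Homotopy r∘f≈id , K , ≈-trans (∘-resp-≈ʳ identityˡ) (≈-sym K∘f≈f∘π₂)
  where
  open Topos T using (≈-trans; ≈-sym; identityˡ)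
  open CategoryProperties (Topos.cat T) using (∘-resp-≈ʳ)
  open Fibrancy T S
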